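{- For every integer $n\geq 2$, there exists a positive integer $m\le \lfloor n/2\rfloor$ such that $\operatorname{aw}([n],3)\leq \operatorname{aw}([m],3)+1$.
   Context: $[m]=\{1,\dots,m\}$. A $3$-AP in a set $S$ of integers is a set of three distinct elements $a,a+d,a+2d$ of $S$ with $d\ge1$. An $r$-coloring is a map $S\to\{1,\dots,r\}$, exact if surjective; a $3$-AP is rainbow if its elements receive distinct colors. $\operatorname{aw}(S,3)$ is the smallest $r$ such that every exact $r$-coloring of $S$ contains a rainbow $3$-AP (with $\operatorname{aw}(S,3)=|S|+1$ if $|S|<3$). -}

module Defs where

open import Data.Nat using (ℕ; suc; _+_; _<_; _≤_; _≥_)
open import Data.Fin using (Fin; toℕ)
open import Data.Product using (Σ; ∃; _×_; ∃-syntax)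
open import Relation.Binary.PropositionalEquality using (_≡_; _≢_)
open import Relation.Nullary using (¬_)

-- [m] = {1,…,m} is represented by Fin m, element i standing for toℕ i + 1.
-- (A translation does not affect 3-APs.)

Coloring : ℕ → ℕ → Set
Coloring m r = Fin m → Fin r

Exact : ∀ {m r} → Coloring m r → Set
Exact {m} {r} c = ∀ (y : Fin r) → ∃[ x ] c x ≡ y

HasRainbow3AP : ∀ {m r} → Coloring m r → Set
HasRainbow3AP {m} c =
  ∃[ x ] ∃[ y ] ∃[ z ] ∃[ d ]
    (d ≥ 1 × toℕ y ≡ toℕ x + d × toℕ z ≡ toℕ y + d
     × c x ≢ c y × c y ≢ c z × c x ≢ c z)

AllExactRainbow : ℕ → ℕ → Set
AllExactRainbow m r = ∀ (c : Coloring m r) → Exact c → HasRainbow3AP c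

-- IsAw m r  :  aw([m],3) = r
-- For m ≥ 3: r is the smallest positive integer with AllExactRainbow m r.
-- For m < 3: aw([m],3) = m + 1 by convention.
IsAw : ℕ → ℕ → Set
IsAw m r with m Data.Nat.<? 3
... | Relation.Nullary.yes _ = r ≡ suc m
... | Relation.Nullary.no _  =
  r ≥ 1 × AllExactRainbow m r × (∀ r' → r' ≥ 1 → r' < r → ¬ AllExactRainbow m r')

-- The heart is a doubling step: if every exact (b+1)-coloring of [m] has a
-- rainbow 3-AP and n ∈ {2m, 2m+1}, then so does every exact (b+2)-coloring c
-- of [n]. Indices are 0-based; the odd indices 1, 3, …, 2m-1 form a copy of [m]
-- dilated by 2. Suppose c had no rainbow 3-AP. A color missing from the odd
-- indices lives on even indices only, and in a rainbow-free coloring such a set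
-- of colors is a single color (midpoint descent, module EvenColours). Merging
-- that color into another one turns c restricted to the odd indices into an
-- exact (b+1)-coloring of [m]; its rainbow 3-AP dilates to one of c.
module Submission where

open import Defs
open import Data.Nat using (ℕ; zero; suc; _+_; _*_; _∸_; _≤_; _<_; _≥_; z≤n; s≤s; _≤?_; _<?_; _≟_)
open import Data.Nat.Properties
open import Data.Nat.DivMod using (_/_; _%_; m≡m%n+[m/n]*n; m%n<n; /-monoˡ-≤)
open import Data.Nat.Divisibility using (_∣_; _∣?_; divides; ∣m+n∣m⇒∣n; m%n≡0⇒n∣m)
open import Data.Nat.Induction using (<-wellFounded)
open import Induction.WellFounded using (Acc; acc)
open import Data.Fin using (Fin; toℕ; fromℕ<; punchIn; punchOut) renaming (zero to fzero; suc to fsuc)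
open import Data.Fin.Properties
  using (all?; any?; ¬∀⟶∃¬; pigeonhole; punchOut-punchIn; punchInᵢ≢i; punchOut-cong;
         toℕ-fromℕ<; toℕ-injective; toℕ<n)
  renaming (_≟_ to _≟ᶠ_; <⇒≢ to <⇒≢ᶠ)
open import Data.Product using (_×_; ∃-syntax; Σ; _,_; proj₁; proj₂)
open import Data.Sum using (inj₁; inj₂)
open import Data.Empty using (⊥; ⊥-elim)
open import Function using (_∘_; _$_)
open import Relation.Unary using (Decidable)
open import Relation.Nullary using (¬_; Dec; yes; no; contradiction)
open import Relation.Nullary.Decidable using (_×-dec_; _→-dec_; ¬?; map′; decidable-stable)
open import Relation.Binary.PropositionalEquality using (_≡_; _≢_; refl; sym; trans; cong; subst; module ≡-Reasoning)

Rainbow : ∀ {m r} → Coloring m r → Fin m → Fin m → Fin m → ℕ → Set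
Rainbow c x y z d =
  d ≥ 1 × toℕ y ≡ toℕ x + d × toℕ z ≡ toℕ y + d × c x ≢ c y × c y ≢ c z × c x ≢ c z

-- The difference of a 3-AP x, y, z is forced to be toℕ y ∸ toℕ x, so only
-- that candidate needs to be tested.
rainbowTriple? : ∀ {m r} (c : Coloring m r) x y z → Dec (∃[ d ] Rainbow c x y z d)
rainbowTriple? c x y z = map′ (D ,_) forced
  ((1 ≤? D) ×-dec (toℕ y ≟ toℕ x + D) ×-dec (toℕ z ≟ toℕ y + D)
    ×-dec ¬? (c x ≟ᶠ c y) ×-dec ¬? (c y ≟ᶠ c z) ×-dec ¬? (c x ≟ᶠ c z))
  where
  D = toℕ y ∸ toℕ x
  forced : ∃[ d ] Rainbow c x y z d → Rainbow c x y z D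
  forced (d , rb@(_ , y≡x+d , _)) =
    subst (Rainbow c x y z) (trans (sym (m+n∸m≡n (toℕ x) d)) (cong (_∸ toℕ x) (sym y≡x+d))) rb

hasRainbow? : ∀ {m r} (c : Coloring m r) → Dec (HasRainbow3AP c)
hasRainbow? c = any? λ x → any? λ y → any? λ z → rainbowTriple? c x y z

exact? : ∀ {m r} (c : Coloring m r) → Dec (Exact c)
exact? c = all? λ y → any? λ x → c x ≟ᶠ y

-- Properties of colorings that only depend on the values. Without function
-- extensionality this is what makes enumerating colorings sound.
Extensional : ∀ {m r} → (Coloring m r → Set) → Set
Extensional Q = ∀ {c c'} → (∀ i → c i ≡ c' i) → Q c → Q c'

exact-ext : ∀ {m r} → Extensional (Exact {m} {r})
exact-ext c≗c' exact y = let (x , cx≡y) = exact y in x , trans (sym (c≗c' x)) cx≡y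

rainbow-ext : ∀ {m r} → Extensional (HasRainbow3AP {m} {r})
rainbow-ext {c = c} {c'} c≗c' (x , y , z , d , d≥1 , ty , tz , x≢y , y≢z , x≢z) =
  x , y , z , d , d≥1 , ty , tz , transport x y x≢y , transport y z y≢z , transport x z x≢z
  where
  transport : ∀ u v → c u ≢ c v → c' u ≢ c' v
  transport u v cu≢cv eq = cu≢cv (trans (c≗c' u) (trans eq (sym (c≗c' v))))

_◃_ : ∀ {m r} → Fin r → Coloring m r → Coloring (suc m) r
(h ◃ t) fzero    = h
(h ◃ t) (fsuc i) = t i

allColourings? : ∀ m {r} (Q : Coloring m r → Set) → (∀ c → Dec (Q c)) → Extensional Q →
                 Dec (∀ c → Q c)
allColourings? zero {r} Q Q? ext = map′ (λ q c → ext (λ ()) q) (_$ empty) (Q? empty)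
  where
  empty : Coloring zero r
  empty ()
allColourings? (suc m) Q Q? ext = map′ fromParts (λ all h t → all (h ◃ t))
  (all? λ h → allColourings? m (Q ∘ (h ◃_)) (Q? ∘ (h ◃_))
                (λ t≗t' → ext λ { fzero → refl ; (fsuc i) → t≗t' i }))
  where
  fromParts : (∀ h t → Q (h ◃ t)) → ∀ c → Q c
  fromParts all c = ext (λ { fzero → refl ; (fsuc i) → refl }) (all (c fzero) (c ∘ fsuc))

allExactRainbow? : ∀ m r → Dec (AllExactRainbow m r)
allExactRainbow? m r = allColourings? m (λ c → Exact c → HasRainbow3AP c)
  (λ c → exact? c →-dec hasRainbow? c)
  (λ c≗c' q exact → rainbow-ext c≗c' (q (exact-ext (sym ∘ c≗c') exact)))

-- With more colors than points no coloring is exact, so the property is vacuous.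
tooManyColours : ∀ {m r} → m < r → AllExactRainbow m r
tooManyColours m<r c exact =
  let (i , j , i<j , eq) = pigeonhole m<r (proj₁ ∘ exact)
  in ⊥-elim (<⇒≢ᶠ i<j (trans (sym (proj₂ (exact i))) (trans (cong c eq) (proj₂ (exact j)))))

leastWitness : ∀ (P : ℕ → Set) → Decidable P → ∀ N → P N →
               ∃[ k ] (P k × ∀ k' → k' < k → ¬ P k')
leastWitness P P? N = search 0 N (λ _ ())
  where
  -- invariant: P fails below k, and P holds at k + j
  search : ∀ k j → (∀ k' → k' < k → ¬ P k') → P (k + j) → ∃[ k ] (P k × ∀ k' → k' < k → ¬ P k')
  search k j below pk+j with P? k
  ... | yes pk = k , pk , below
  search k zero    below pk+j | no ¬pk = contradiction (subst P (+-identityʳ k) pk+j) ¬pk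
  search k (suc j) below pk+j | no ¬pk = search (suc k) j below′ (subst P (+-suc k j) pk+j)
    where
    below′ : ∀ k' → k' < suc k → ¬ P k'
    below′ k' k'<1+k with m<1+n⇒m<n∨m≡n k'<1+k
    ... | inj₁ k'<k = below k' k'<k
    ... | inj₂ refl = ¬pk

Minimal : ℕ → ℕ → Set
Minimal m r = ∀ r' → r' ≥ 1 → r' < r → ¬ AllExactRainbow m r'

isAw-small : ∀ {m} → m < 3 → IsAw m (suc m)
isAw-small {m} m<3 with m <? 3
... | yes _   = refl
... | no m≮3 = contradiction m<3 m≮3

isAw-large : ∀ {m r} → 3 ≤ m → r ≥ 1 → AllExactRainbow m r → Minimal m r → IsAw m r
isAw-large {m} 3≤m r≥1 aer minimal with m <? 3
... | yes m<3 = contradiction 3≤m (<⇒≱ m<3)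
... | no _    = r≥1 , aer , minimal

isAw-minimal : ∀ {m r} → 3 ≤ m → IsAw m r → Minimal m r
isAw-minimal {m} 3≤m isAw with m <? 3
... | yes m<3 = contradiction 3≤m (<⇒≱ m<3)
... | no _    = proj₂ (proj₂ isAw)

-- aw([m],3) exists; moreover its value has the rainbow property itself
-- (vacuously so in the conventional case m < 3).
aw-exists : ∀ m → ∃[ b ] (IsAw m b × b ≥ 1 × AllExactRainbow m b)
aw-exists m with 3 ≤? m
... | no 3≰m = suc m , isAw-small (≰⇒> 3≰m) , s≤s z≤n , tooManyColours ≤-refl
... | yes 3≤m =
  let (k , aer , below) = leastWitness (AllExactRainbow m ∘ suc) (allExactRainbow? m ∘ suc)
                                       m (tooManyColours ≤-refl)
      minimal : Minimal m (suc k)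
      minimal = λ { (suc k') _ k'<k → below k' (≤-pred k'<k) }
  in suc k , isAw-large 3≤m (s≤s z≤n) aer minimal , s≤s z≤n , aer

halving : ∀ n → n / 2 * 2 ≤ n × n ≤ suc (n / 2 * 2)
halving n = subst (n / 2 * 2 ≤_) (sym n≡) (m≤n+m _ _) , subst (_≤ suc (n / 2 * 2)) (sym n≡)
              (+-monoˡ-≤ _ (≤-pred (m%n<n n 2)))
  where
  n≡ : n ≡ n % 2 + n / 2 * 2
  n≡ = m≡m%n+[m/n]*n n 2

odd-decomposition : ∀ x → ¬ 2 ∣ x → x ≡ suc (x / 2 * 2)
odd-decomposition x ¬2∣x with x % 2 in eq | m%n<n x 2
... | 0           | _ = contradiction (m%n≡0⇒n∣m x 2 eq) ¬2∣x
... | 1           | _ = trans (m≡m%n+[m/n]*n x 2) (cong (_+ x / 2 * 2) eq)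
... | suc (suc _) | s≤s (s≤s ())

twice : ∀ q → q * 2 ≡ q + q
twice q = trans (*-comm q 2) (cong (q +_) (+-identityʳ q))

midpoint : ∀ {n} (x z : Fin n) q → toℕ z ≡ toℕ x + (q + q) →
           Σ (Fin n) λ y → toℕ y ≡ toℕ x + q × toℕ z ≡ toℕ y + q
midpoint x z q z≡x+2q = y , toℕ-fromℕ< x+q<n , trans z≡x+q+q (cong (_+ q) (sym (toℕ-fromℕ< x+q<n)))
  where
  z≡x+q+q : toℕ z ≡ toℕ x + q + q
  z≡x+q+q = trans z≡x+2q (sym (+-assoc (toℕ x) q q))
  x+q<n : toℕ x + q < _
  x+q<n = ≤-<-trans (subst (toℕ x + q ≤_) (sym z≡x+q+q) (m≤m+n _ q)) (toℕ<n z)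
  y = fromℕ< x+q<n

rainbow-pullback : ∀ {m n r k} (c : Coloring n r) (e : Fin m → Fin n) (s : ℕ) → 1 ≤ s →
  (∀ u v w → toℕ v ≡ toℕ u + w → toℕ (e v) ≡ toℕ (e u) + w * s) →
  (g : Fin r → Fin k) → HasRainbow3AP (g ∘ c ∘ e) → HasRainbow3AP c
rainbow-pullback c e s s≥1 scale g (x , y , z , d , d≥1 , ty , tz , x≢y , y≢z , x≢z) =
  e x , e y , e z , d * s , *-mono-≤ d≥1 s≥1 , scale x y d ty , scale y z d tz ,
  x≢y ∘ cong g , y≢z ∘ cong g , x≢z ∘ cong g

-- Two S-points x < z of different colors have
-- an even distance 2q; the midpoint repeats the color of x or of z, giving such
-- a pair at distance q. By descent, all S-points have the same color.
module EvenColours {n r} (c : Coloring n r) (noRainbow : ¬ HasRainbow3AP c)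
                   (S : Fin r → Set) (S-even : ∀ x → S (c x) → 2 ∣ toℕ x) where

  descent : ∀ d → Acc _<_ d → ∀ x z → toℕ z ≡ toℕ x + d → S (c x) → S (c z) → c x ≢ c z → ⊥
  descent zero _ x z z≡x+0 _ _ cx≢cz =
    cx≢cz (cong c (toℕ-injective (sym (trans z≡x+0 (+-identityʳ (toℕ x))))))
  descent (suc d) (acc smaller) x z z≡x+d Sx Sz cx≢cz
    with ∣m+n∣m⇒∣n (subst (2 ∣_) z≡x+d (S-even z Sz)) (S-even x Sx)
  ... | divides (suc q′) d≡q*2 = split (c y ≟ᶠ c x) (c y ≟ᶠ c z)
    where
    q = suc q′
    q<d : q < suc d
    q<d = subst (q <_) (sym d≡q*2) (m<m*n q 2 (s≤s (s≤s z≤n)))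
    mid = midpoint x z q (trans z≡x+d (cong (toℕ x +_) (trans d≡q*2 (twice q))))
    y = proj₁ mid
    y≡x+q = proj₁ (proj₂ mid)
    z≡y+q = proj₂ (proj₂ mid)
    split : Dec (c y ≡ c x) → Dec (c y ≡ c z) → ⊥
    split (yes cy≡cx) _ = descent q (smaller q<d) y z z≡y+q
      (subst S (sym cy≡cx) Sx) Sz (cx≢cz ∘ trans (sym cy≡cx))
    split (no _) (yes cy≡cz) = descent q (smaller q<d) x y y≡x+q
      Sx (subst S (sym cy≡cz) Sz) (λ cx≡cy → cx≢cz (trans cx≡cy cy≡cz))
    split (no cy≢cx) (no cy≢cz) =
      noRainbow (x , y , z , q , s≤s z≤n , y≡x+q , z≡y+q , cy≢cx ∘ sym , cy≢cz , cx≢cz)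

  monochromatic : ∀ x z → S (c x) → S (c z) → c x ≡ c z
  monochromatic x z Sx Sz with c x ≟ᶠ c z | ≤-total (toℕ x) (toℕ z)
  ... | yes cx≡cz | _ = cx≡cz
  ... | no cx≢cz | inj₁ x≤z =
    ⊥-elim (descent _ (<-wellFounded _) x z (sym (m+[n∸m]≡n x≤z)) Sx Sz cx≢cz)
  ... | no cx≢cz | inj₂ z≤x =
    ⊥-elim (descent _ (<-wellFounded _) z x (sym (m+[n∸m]≡n z≤x)) Sz Sx (cx≢cz ∘ sym))

  atMostOne : Exact c → ∀ A B → S A → S B → A ≡ B
  atMostOne exact A B SA SB with exact A | exact B
  ... | xA , refl | xB , refl = monochromatic xA xB SA SB

-- Merging a color M of k+2 colors into another: a map onto k+1 colors that
-- stays surjective on the colors other than M.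
merge : ∀ {k} (M : Fin (suc (suc k))) → Fin (suc (suc k)) → Fin (suc k)
merge M y with M ≟ᶠ y
... | yes _   = fzero
... | no M≢y = punchOut M≢y

merge-onto : ∀ {k} (M : Fin (suc (suc k))) (y : Fin (suc k)) → ∃[ x ] (x ≢ M × merge M x ≡ y)
merge-onto M y = punchIn M y , punchInᵢ≢i M y , merge-punchIn
  where
  merge-punchIn : merge M (punchIn M y) ≡ y
  merge-punchIn with M ≟ᶠ punchIn M y
  ... | yes M≡ = contradiction (sym M≡) (punchInᵢ≢i M y)
  ... | no _   = trans (punchOut-cong M refl) (punchOut-punchIn M)

module Doubling {m n b} (2m≤n : m * 2 ≤ n) (n≤2m+1 : n ≤ suc (m * 2))
                (aer : AllExactRainbow m (suc b))
                (c : Coloring n (suc (suc b))) (exact : Exact c) where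

  -- the odd index 2i+1 of [n]
  odd : Fin m → Fin n
  odd i = fromℕ< (≤-trans (*-monoˡ-≤ 2 (toℕ<n i)) 2m≤n)

  odd-scaling : ∀ u v w → toℕ v ≡ toℕ u + w → toℕ (odd v) ≡ toℕ (odd u) + w * 2
  odd-scaling u v w v≡u+w = begin
    toℕ (odd v)              ≡⟨ toℕ-fromℕ< _ ⟩
    suc (toℕ v * 2)          ≡⟨ cong (λ t → suc (t * 2)) v≡u+w ⟩
    suc ((toℕ u + w) * 2)    ≡⟨ cong suc (*-distribʳ-+ 2 (toℕ u) w) ⟩
    suc (toℕ u * 2) + w * 2  ≡⟨ cong (_+ w * 2) (toℕ-fromℕ< _) ⟨
    toℕ (odd u) + w * 2      ∎
    where open ≡-Reasoning

  -- since n ≤ 2m+1, every odd index is of this form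
  odd-onto : ∀ x → ¬ 2 ∣ toℕ x → ∃[ i ] odd i ≡ x
  odd-onto x x-odd = fromℕ< k<m , toℕ-injective (begin
    toℕ (odd (fromℕ< k<m))  ≡⟨ toℕ-fromℕ< _ ⟩
    suc (toℕ (fromℕ< k<m) * 2)  ≡⟨ cong (λ t → suc (t * 2)) (toℕ-fromℕ< k<m) ⟩
    suc (toℕ x / 2 * 2)     ≡⟨ odd-decomposition (toℕ x) x-odd ⟨
    toℕ x                   ∎)
    where
    open ≡-Reasoning
    k<m : toℕ x / 2 < m
    k<m = *-cancelʳ-< 2 _ m (≤-pred (≤-trans
            (subst (_< n) (odd-decomposition (toℕ x) x-odd) (toℕ<n x)) n≤2m+1))

  Seen : Fin (suc (suc b)) → Set
  Seen y = ∃[ i ] c (odd i) ≡ y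

  seen? : Decidable Seen
  seen? y = any? λ i → c (odd i) ≟ᶠ y

  unseen-even : ∀ x → ¬ Seen (c x) → 2 ∣ toℕ x
  unseen-even x unseen = decidable-stable (2 ∣? toℕ x)
    (λ x-odd → let (i , oddi≡x) = odd-onto x x-odd in unseen (i , cong c oddi≡x))

  oneUnseen : ¬ HasRainbow3AP c → ∃[ M ] (∀ y → y ≢ M → Seen y)
  oneUnseen noRainbow with all? seen?
  ... | yes allSeen = fzero , λ y _ → allSeen y
  ... | no ¬allSeen =
    let (M , unseenM) = ¬∀⟶∃¬ _ Seen seen? ¬allSeen
    in M , λ y y≢M → decidable-stable (seen? y)
             (λ unseenY → y≢M (EvenColours.atMostOne c noRainbow (¬_ ∘ Seen) unseen-even
                                 exact y M unseenY unseenM))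

  -- merging the missing color, c on the odd indices is an exact coloring of [m]
  rainbow : HasRainbow3AP c
  rainbow with hasRainbow? c
  ... | yes found = found
  ... | no noRainbow =
    let (M , seenExceptM) = oneUnseen noRainbow
        restricted-exact : Exact (merge M ∘ c ∘ odd)
        restricted-exact y =
          let (x , x≢M , mx≡y) = merge-onto M y
              (i , ci≡x) = seenExceptM x x≢M
          in i , trans (cong (merge M) ci≡x) mx≡y
    in rainbow-pullback c odd 2 (s≤s z≤n) odd-scaling (merge M)
         (aer (merge M ∘ c ∘ odd) restricted-exact)

doubling : ∀ {m n b} → m * 2 ≤ n → n ≤ suc (m * 2) →
           AllExactRainbow m (suc b) → AllExactRainbow n (suc (suc b))
doubling 2m≤n n≤2m+1 aer c exact = Doubling.rainbow 2m≤n n≤2m+1 aer c exact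

-- aw([n],3) ≤ aw([⌊n/2⌋],3) + 1 for n ≥ 3, by minimality of aw([n],3).
aw-halving : ∀ n → 3 ≤ n → ∃[ a ] ∃[ b ] (IsAw n a × IsAw (n / 2) b × a ≤ b + 1)
aw-halving n 3≤n with aw-exists n | aw-exists (n / 2)
... | a , isAw-n , _ | suc b , isAw-m , _ , aer =
  a , suc b , isAw-n , isAw-m , ≤-trans a≤2+b (≤-reflexive (+-comm 1 (suc b)))
  where
  a≤2+b : a ≤ suc (suc b)
  a≤2+b = ≮⇒≥ λ 2+b<a → isAw-minimal 3≤n isAw-n (suc (suc b)) (s≤s z≤n) 2+b<a
            (doubling (proj₁ (halving n)) (proj₂ (halving n)) aer)

proposition2p18 : ∀ (n : ℕ) → n ≥ 2 →
    ∃[ m ] (1 ≤ m × m ≤ n / 2 ×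
    ∃[ a ] ∃[ b ] (IsAw n a × IsAw m b × a ≤ b + 1))
proposition2p18 (suc (suc zero)) _ = 1 , ≤-refl , ≤-refl , 3 , 2 , refl , refl , ≤-refl
proposition2p18 n@(suc (suc (suc _))) n≥2 =
  n / 2 , /-monoˡ-≤ 2 n≥2 , ≤-refl , aw-halving n (s≤s (s≤s (s≤s z≤n)))
proposition2p18 (suc zero) (s≤s ())
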